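{- Let $T$ be a tree on a finite set $I$. For any $J \subseteq I$, there exists a unique tree $T_J$ on $J$ such that $T_J \sqcup |_{I\setminus J} \leq T$ in the poset $\operatorname{For}(I)$.
   Context: A tree on a finite set $I$ is a rooted binary tree (not considered as planar) whose leaves are bijectively labeled by $I$: every vertex is either an inner vertex of valence 3, or a vertex of valence 1 (a leaf or the root); edges are oriented towards the root. A forest on $I$ is a set of trees on pairwise disjoint label sets whose union is $I$. For a forest $F$, $\mathcal V(F)$ is its set of inner vertices and $\mathcal L(F)$ its set of leaves. For forests $F_1,\dots,F_k$ on pairwise disjoint sets, $F_1\sqcup\dots\sqcup F_k$ is their disjoint union (a forest on the union of the sets). For $J\subseteq I$, $|_J$ denotes the forest on $J$ with no inner vertices (each element of $J$ is a leaf joined directly to its own root). For forests $F,G$ on $I$, $F\le G$ means there is a continuous map from $F$ to $G$ (forests viewed as 1-dimensional complexes) such that: (D1) it is increasing with respect to the orientation towards the root; (D2) it maps inner vertices to inner vertices injectively; (D3) it restricts to the identity of $I$ on leaves; (D4) its restriction to each tree of $F$ is injective. $\operatorname{For}(I)$ denotes the set of forests on $I$ with this partial order. -}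

module Defs where

open import Data.Nat using (ℕ; zero; suc)
open import Data.Fin using (Fin)
open import Data.Fin.Subset as S using (Subset; _∉_)
import Data.Fin.Subset.Properties as SP
open import Data.List using (List; []; _∷_; _++_; filter; [_])
open import Data.List.Relation.Unary.Unique.Propositional using (Unique)
open import Data.List.Membership.Propositional as LM using ()
open import Data.Maybe using (Maybe; just; nothing)
open import Data.Product using (Σ; ∃; _×_; _,_)
open import Data.Sum using (_⊎_)
open import Function.Bundles using (_⇔_)
open import Relation.Binary.PropositionalEquality using (_≡_)
import Data.List.Base as LB

-- Label set I is modelled as Fin n (any finite set, up to relabelling).
-- A (rooted, binary) tree with leaves labelled by elements of Fin n.
-- 'leaf i' is the tree whose only non-root vertex is the leaf i (joined
-- directly to the root); 'node l r' has an inner vertex with the two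
-- subtrees l, r as children.  The root is the valence-1 vertex above the
-- topmost vertex and is not represented explicitly.

data BTree (n : ℕ) : Set where
  leaf : Fin n → BTree n
  node : BTree n → BTree n → BTree n

leaves : ∀ {n} → BTree n → List (Fin n)
leaves (leaf i)   = i ∷ []
leaves (node l r) = leaves l ++ leaves r

IsTreeOn : ∀ {n} → Subset n → BTree n → Set
IsTreeOn J t = Unique (leaves t) × (∀ i → (i LM.∈ leaves t) ⇔ (i S.∈ J))

-- Trees are not planar: isomorphism of labelled trees = equality up to
-- swapping children at inner vertices.
data _≅_ {n : ℕ} : BTree n → BTree n → Set where
  leaf : ∀ i → leaf i ≅ leaf i
  node : ∀ {l r l′ r′} → l ≅ l′ → r ≅ r′ → node l r ≅ node l′ r′
  swap : ∀ {l r l′ r′} → l ≅ r′ → r ≅ l′ → node l r ≅ node l′ r′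

Forest : ℕ → Set
Forest n = List (BTree n)

-- |_K : one leaf-root tree (no inner vertex) per element of K.
bars : ∀ {n} → Subset n → Forest n
bars {n} K = LB.map leaf (filter (λ i → i SP.∈? K) (LB.allFin n))

-- Vertices of a forest (other than roots) are addressed by the index of
-- the tree in the list and the path (left/right) from the top vertex.

data Dir : Set where
  L R : Dir

Addr : Set
Addr = ℕ × List Dir

subAt : ∀ {n} → BTree n → List Dir → Maybe (BTree n)
subAt t          []      = just t
subAt (leaf _)   (_ ∷ _) = nothing
subAt (node l r) (L ∷ p) = subAt l p
subAt (node l r) (R ∷ p) = subAt r p

treeAt : ∀ {n} → Forest n → ℕ → Maybe (BTree n)
treeAt []      _       = nothing
treeAt (t ∷ F) zero    = just t
treeAt (t ∷ F) (suc k) = treeAt F k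

atF : ∀ {n} → Forest n → Addr → Maybe (BTree n)
atF F (k , p) with treeAt F k
... | just t  = subAt t p
... | nothing = nothing

Inner : ∀ {n} → Forest n → Addr → Set
Inner F a = ∃ λ l → ∃ λ r → atF F a ≡ just (node l r)

LeafAt : ∀ {n} → Forest n → Addr → Fin n → Set
LeafAt F a i = atF F a ≡ just (leaf i)

_▷_ : Addr → Dir → Addr
(k , p) ▷ d = k , (p ++ [ d ])

Below : Addr → Addr → Set
Below (k , p) (k′ , q) = k ≡ k′ × ∃ λ s → p ≡ q ++ s

-- The image (under the map determined by φ on inner vertices and the
-- identity on leaves) of the vertex c of F lies at or below q in G.
ImgBelow : ∀ {n} → Forest n → Forest n → (Addr → Addr) → Addr → Addr → Set
ImgBelow F G φ c q =
    (Inner F c × Below (φ c) q)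
  ⊎ (∃ λ i → LeafAt F c i × ∃ λ b → LeafAt G b i × Below b q)

-- The order F ≤ G on forests, i.e. the existence of a continuous map
-- F → G with (D1)-(D4).  Such a map is determined (up to homotopy
-- through such maps) by its values on vertices: inner vertices go
-- injectively to inner vertices (D2), leaves go identically to leaves
-- (D3), each edge goes to the increasing path between the images of
-- its endpoints (D1), and injectivity on each tree (D4) means that the
-- two children of an inner vertex v are sent strictly below φ v into the
-- two different child branches of φ v.  (Root edges impose nothing.)

record _≤F_ {n : ℕ} (F G : Forest n) : Set where
  field
    φ       : Addr → Addr
    inner   : ∀ a → Inner F a → Inner G (φ a)
    φ-inj   : ∀ a b → Inner F a → Inner F b → φ a ≡ φ b → a ≡ b
    edges   : ∀ a → Inner F a →
                (ImgBelow F G φ (a ▷ L) (φ a ▷ L) × ImgBelow F G φ (a ▷ R) (φ a ▷ R))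
              ⊎ (ImgBelow F G φ (a ▷ L) (φ a ▷ R) × ImgBelow F G φ (a ▷ R) (φ a ▷ L))

module Submission where

-- Write s ⊑ t when t contains a subdivided copy of s, i.e. s arises from t by deleting leaves
-- and suppressing the vertices of valence 2 this creates.  A morphism from s ⊔ (bare leaves)
-- to a single tree t is the same thing as such a copy: the copy sends vertices along itself,
-- and conversely, following a morphism down from the root of s traces out a copy.
-- Restricting T to J is a copy T_J ⊑ T, which gives existence.  As the leaf labels of T are
-- distinct, a copy T′ ⊑ T is recovered up to isomorphism by restricting T to the leaves of T′;
-- these are J, so T′ ≅ T_J.

open import Defs
open import Data.Empty using (⊥-elim)
open import Data.Fin using (Fin)
open import Data.Fin.Subset using (Subset; ⊤; ∁; Nonempty; _∩_) renaming (_∈_ to _∈ₛ_)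
open import Data.Fin.Subset.Properties using (∈⊤; _∈?_; ∩-identityˡ; x∈p∩q⁺; x∈p∩q⁻)
open import Data.List using (List; []; _∷_; _++_; [_]; filter; map)
open import Data.List.Membership.Propositional using (_∈_)
open import Data.List.Membership.Propositional.Properties
  using (∈-++⁺ˡ; ∈-++⁺ʳ; ∈-++⁻; ∈-filter⁺; ∈-filter⁻)
open import Data.List.Properties using (∷-injectiveʳ; ++-identityʳ; filter-++)
open import Data.List.Relation.Binary.Disjoint.Propositional using (Disjoint)
open import Data.List.Relation.Binary.Subset.Propositional using (_⊆_)
import Data.List.Relation.Unary.All as All
import Data.List.Relation.Unary.All.Properties as All
open import Data.List.Relation.Unary.AllPairs using ([]; _∷_)
open import Data.List.Relation.Unary.Any using (here; there)
open import Data.List.Relation.Unary.Unique.Propositional using (Unique)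
import Data.List.Relation.Unary.Unique.Propositional.Properties as Unique
open import Data.Maybe using (Maybe; just; nothing)
open import Data.Maybe.Properties using (just-injective)
open import Data.Nat using (ℕ; zero; suc)
open import Data.Product using (∃; ∃₂; _×_; _,_; proj₁; proj₂)
import Data.Sum as Sum
open import Data.Sum using (_⊎_; inj₁; inj₂)
open import Function using (id; _∘_)
open import Function.Bundles using (_⇔_; mk⇔; Equivalence)
open import Level using (Level)
open import Relation.Binary.PropositionalEquality using (_≡_; refl; sym; trans; cong; cong₂; subst; module ≡-Reasoning)
open import Relation.Nullary using (¬_; yes; no; contradiction)
open import Relation.Unary using (Pred; Decidable)

private
  variable
    ℓ : Level
    n : ℕ
    i : Fin n
    a b s t u v : BTree n
    p q : List Dir
    xs ys zs : List (Fin n)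

Unique-++⁻ : ∀ xs → Unique (xs ++ ys) → Unique xs × Unique ys × Disjoint xs ys
Unique-++⁻ []       ys!          = [] , ys! , λ ()
Unique-++⁻ (x ∷ xs) (x∉ ∷ xsys!) =
  let xs! , ys! , xs#ys = Unique-++⁻ xs xsys! in
    All.++⁻ˡ xs x∉ ∷ xs! , ys!
  , λ { (here refl , v∈ys) → All.lookup (All.++⁻ʳ xs x∉) v∈ys refl
      ; (there v∈xs , v∈ys) → xs#ys (v∈xs , v∈ys) }

subAt-++ : ∀ (t : BTree n) p q → subAt t p ≡ just u → subAt t (p ++ q) ≡ subAt u q
subAt-++ t          []      q refl = refl
subAt-++ (node l r) (L ∷ p) q eq   = subAt-++ l p q eq
subAt-++ (node l r) (R ∷ p) q eq   = subAt-++ r p q eq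

∈-leaves⇒subAt : ∀ t → i ∈ leaves t → ∃ λ p → subAt t p ≡ just (leaf i)
∈-leaves⇒subAt (leaf _)   (here refl) = [] , refl
∈-leaves⇒subAt (node l r) i∈lr with ∈-++⁻ (leaves l) i∈lr
... | inj₁ i∈l = let p , eq = ∈-leaves⇒subAt l i∈l in L ∷ p , eq
... | inj₂ i∈r = let p , eq = ∈-leaves⇒subAt r i∈r in R ∷ p , eq

Inner-suc : ∀ (t : BTree n) F k p → Inner (t ∷ F) (suc k , p) → Inner F (k , p)
Inner-suc t F k p inn with treeAt F k
... | just _  = inn
... | nothing = inn

Inner-singleton⇒zero : ∀ {k} → Inner (t ∷ []) (k , p) → k ≡ zero
Inner-singleton⇒zero {k = zero} _ = refl

¬Inner-map-leaf : ∀ xs k p → ¬ Inner (map (leaf {n}) xs) (k , p)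
¬Inner-map-leaf (x ∷ xs) zero    []      (_ , _ , ())
¬Inner-map-leaf (x ∷ xs) zero    (_ ∷ _) (_ , _ , ())
¬Inner-map-leaf (x ∷ xs) (suc k) p       inn =
  ¬Inner-map-leaf xs k p (Inner-suc (leaf x) (map leaf xs) k p inn)

infix 4 _⊑_

data _⊑_ {n : ℕ} : BTree n → BTree n → Set where
  leaf  : ∀ i → leaf i ⊑ leaf i
  node  : a ⊑ u → b ⊑ v → node a b ⊑ node u v
  swap  : a ⊑ v → b ⊑ u → node a b ⊑ node u v
  left  : s ⊑ u → s ⊑ node u v
  right : s ⊑ v → s ⊑ node u v

⊑-subAt : ∀ q → subAt t q ≡ just u → s ⊑ u → s ⊑ t
⊑-subAt []            refl s⊑u = s⊑u
⊑-subAt {t = node _ _} (L ∷ q) eq s⊑u = left  (⊑-subAt q eq s⊑u)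
⊑-subAt {t = node _ _} (R ∷ q) eq s⊑u = right (⊑-subAt q eq s⊑u)

⊑⇒leaves⊆ : s ⊑ t → leaves s ⊆ leaves t
⊑⇒leaves⊆ (leaf i) i∈s = i∈s
⊑⇒leaves⊆ (node {a = a} {u = u} a⊑u b⊑v) i∈ab with ∈-++⁻ (leaves a) i∈ab
... | inj₁ i∈a = ∈-++⁺ˡ (⊑⇒leaves⊆ a⊑u i∈a)
... | inj₂ i∈b = ∈-++⁺ʳ (leaves u) (⊑⇒leaves⊆ b⊑v i∈b)
⊑⇒leaves⊆ (swap {a = a} {u = u} a⊑v b⊑u) i∈ab with ∈-++⁻ (leaves a) i∈ab
... | inj₁ i∈a = ∈-++⁺ʳ (leaves u) (⊑⇒leaves⊆ a⊑v i∈a)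
... | inj₂ i∈b = ∈-++⁺ˡ (⊑⇒leaves⊆ b⊑u i∈b)
⊑⇒leaves⊆ (left s⊑u)             i∈s = ∈-++⁺ˡ (⊑⇒leaves⊆ s⊑u i∈s)
⊑⇒leaves⊆ (right {u = u} s⊑v)    i∈s = ∈-++⁺ʳ (leaves u) (⊑⇒leaves⊆ s⊑v i∈s)

Extends : List Dir → List Dir → Set
Extends p q = ∃ λ r → p ≡ q ++ r

extends-∷ : ∀ {d} → Extends p q → Extends (d ∷ p) (d ∷ q)
extends-∷ (r , refl) = r , refl

flip : Dir → Dir
flip L = R
flip R = L

Branching : (Dir → Dir) → (List Dir → List Dir) → List Dir → Set
Branching σ f p = ∀ d → Extends (f (p ++ [ d ])) (f p ++ [ σ d ])

embed : s ⊑ t → List Dir → List Dir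
embed (leaf i)   p       = p
embed (node _ _) []      = []
embed (node e _) (L ∷ p) = L ∷ embed e p
embed (node _ e) (R ∷ p) = R ∷ embed e p
embed (swap _ _) []      = []
embed (swap e _) (L ∷ p) = R ∷ embed e p
embed (swap _ e) (R ∷ p) = L ∷ embed e p
embed (left e)   p       = L ∷ embed e p
embed (right e)  p       = R ∷ embed e p

embed-injective : (e : s ⊑ t) → embed e p ≡ embed e q → p ≡ q
embed-injective {p = p}     {q}     (leaf i)   eq = eq
embed-injective {p = []}    {[]}    (node _ _) eq = refl
embed-injective {p = []}    {L ∷ _} (node _ _) ()
embed-injective {p = []}    {R ∷ _} (node _ _) ()
embed-injective {p = L ∷ p} {L ∷ q} (node e _) eq = cong (L ∷_) (embed-injective e (∷-injectiveʳ eq))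
embed-injective {p = R ∷ p} {R ∷ q} (node _ e) eq = cong (R ∷_) (embed-injective e (∷-injectiveʳ eq))
embed-injective {p = []}    {[]}    (swap _ _) eq = refl
embed-injective {p = []}    {L ∷ _} (swap _ _) ()
embed-injective {p = []}    {R ∷ _} (swap _ _) ()
embed-injective {p = L ∷ p} {L ∷ q} (swap e _) eq = cong (L ∷_) (embed-injective e (∷-injectiveʳ eq))
embed-injective {p = R ∷ p} {R ∷ q} (swap _ e) eq = cong (R ∷_) (embed-injective e (∷-injectiveʳ eq))
embed-injective                     (left e)   eq = embed-injective e (∷-injectiveʳ eq)
embed-injective                     (right e)  eq = embed-injective e (∷-injectiveʳ eq)

embed-leaf : (e : s ⊑ t) → subAt s p ≡ just (leaf i) → subAt t (embed e p) ≡ just (leaf i)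
embed-leaf {p = []}    (leaf i)   eq = eq
embed-leaf {p = L ∷ p} (node e _) eq = embed-leaf e eq
embed-leaf {p = R ∷ p} (node _ e) eq = embed-leaf e eq
embed-leaf {p = L ∷ p} (swap e _) eq = embed-leaf e eq
embed-leaf {p = R ∷ p} (swap _ e) eq = embed-leaf e eq
embed-leaf             (left e)   eq = embed-leaf e eq
embed-leaf             (right e)  eq = embed-leaf e eq

embed-node : (e : s ⊑ t) → subAt s p ≡ just (node a b) → ∃₂ λ u v → subAt t (embed e p) ≡ just (node u v)
embed-node {p = []}    (node _ _) _  = _ , _ , refl
embed-node {p = L ∷ p} (node e _) eq = embed-node e eq
embed-node {p = R ∷ p} (node _ e) eq = embed-node e eq
embed-node {p = []}    (swap _ _) _  = _ , _ , refl
embed-node {p = L ∷ p} (swap e _) eq = embed-node e eq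
embed-node {p = R ∷ p} (swap _ e) eq = embed-node e eq
embed-node             (left e)   eq = embed-node e eq
embed-node             (right e)  eq = embed-node e eq

embed-branching : (e : s ⊑ t) → subAt s p ≡ just (node a b) →
                  Branching id (embed e) p ⊎ Branching flip (embed e) p
embed-branching {p = []}    (node e f) _  = inj₁ λ { L → embed e [] , refl ; R → embed f [] , refl }
embed-branching {p = L ∷ p} (node e _) eq = Sum.map (extends-∷ ∘_) (extends-∷ ∘_) (embed-branching e eq)
embed-branching {p = R ∷ p} (node _ e) eq = Sum.map (extends-∷ ∘_) (extends-∷ ∘_) (embed-branching e eq)
embed-branching {p = []}    (swap e f) _  = inj₂ λ { L → embed e [] , refl ; R → embed f [] , refl }
embed-branching {p = L ∷ p} (swap e _) eq = Sum.map (extends-∷ ∘_) (extends-∷ ∘_) (embed-branching e eq)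
embed-branching {p = R ∷ p} (swap _ e) eq = Sum.map (extends-∷ ∘_) (extends-∷ ∘_) (embed-branching e eq)
embed-branching             (left e)   eq = Sum.map (extends-∷ ∘_) (extends-∷ ∘_) (embed-branching e eq)
embed-branching             (right e)  eq = Sum.map (extends-∷ ∘_) (extends-∷ ∘_) (embed-branching e eq)

⊑⇒≤F : ∀ {n} {s t : BTree n} {xs} → s ⊑ t → (s ∷ map leaf xs) ≤F (t ∷ [])
⊑⇒≤F {n} {s} {t} {xs} e = record { φ = φ ; inner = inner ; φ-inj = φ-inj ; edges = edges }
  where
    F : Forest n
    F = s ∷ map leaf xs

    ¬Inner-bar : ∀ k p → ¬ Inner F (suc k , p)
    ¬Inner-bar k p inn = ¬Inner-map-leaf xs k p (Inner-suc s (map leaf xs) k p inn)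

    φ : Addr → Addr
    φ (zero  , p) = zero , embed e p
    φ (suc _ , _) = zero , []

    image-below : ∀ c q → subAt s c ≡ just u → Extends (embed e c) q →
                  ImgBelow F (t ∷ []) φ (zero , c) (zero , q)
    image-below {u = node _ _} c q sc c↦q = inj₁ ((_ , _ , sc) , refl , c↦q)
    image-below {u = leaf i}   c q sc c↦q = inj₂ (i , sc , (zero , embed e c) , embed-leaf e sc , refl , c↦q)

    inner : ∀ a → Inner F a → Inner (t ∷ []) (φ a)
    inner (zero  , p) (_ , _ , sp) = embed-node e sp
    inner (suc k , p) inn          = ⊥-elim (¬Inner-bar k p inn)

    φ-inj : ∀ a b → Inner F a → Inner F b → φ a ≡ φ b → a ≡ b
    φ-inj (zero  , p) (zero  , q) _   _   eq = cong (zero ,_) (embed-injective e (cong proj₂ eq))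
    φ-inj (zero  , _) (suc k , q) _   inn _  = ⊥-elim (¬Inner-bar k q inn)
    φ-inj (suc k , p) _           inn _   _  = ⊥-elim (¬Inner-bar k p inn)

    edges : ∀ a → Inner F a →
              (ImgBelow F (t ∷ []) φ (a ▷ L) (φ a ▷ L) × ImgBelow F (t ∷ []) φ (a ▷ R) (φ a ▷ R))
            ⊎ (ImgBelow F (t ∷ []) φ (a ▷ L) (φ a ▷ R) × ImgBelow F (t ∷ []) φ (a ▷ R) (φ a ▷ L))
    edges (zero , p) (_ , _ , sp) with embed-branching e sp
    ... | inj₁ straight = inj₁ ( image-below _ _ (subAt-++ s p [ L ] sp) (straight L)
                               , image-below _ _ (subAt-++ s p [ R ] sp) (straight R))
    ... | inj₂ crossed  = inj₂ ( image-below _ _ (subAt-++ s p [ L ] sp) (crossed L)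
                               , image-below _ _ (subAt-++ s p [ R ] sp) (crossed R))
    edges (suc k , p) inn = ⊥-elim (¬Inner-bar k p inn)

module _ {s t : BTree n} {xs : List (Fin n)} (E : (s ∷ map leaf xs) ≤F (t ∷ [])) where
  open _≤F_ E

  private
    F : Forest n
    F = s ∷ map leaf xs

  imgBelow⇒⊑ : ImgBelow F (t ∷ []) φ (zero , p) (zero , q) → subAt s p ≡ just u → subAt t q ≡ just v → u ⊑ v
  imgBelow⇒⊑ {u = leaf _} (inj₁ ((_ , _ , sp′) , _)) sp _ = contradiction (trans (sym sp) sp′) λ ()
  imgBelow⇒⊑ {q = q} {u = leaf i} (inj₂ (_ , sp′ , _ , tr , refl , w , refl)) sp tq
    with refl ← trans (sym sp) sp′ = ⊑-subAt w (trans (sym (subAt-++ t q w tq)) tr) (leaf i)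
  imgBelow⇒⊑ {u = node _ _} (inj₂ (_ , sp′ , _)) sp _ = contradiction (trans (sym sp′) sp) λ ()
  imgBelow⇒⊑ {p = p} {q} {u = node _ _} (inj₁ (inn , below)) sp tq
    with φ (zero , p) | inner (zero , p) inn | edges (zero , p) inn | below
  ... | _ , _ | _ , _ , tr | inj₁ (img-L , img-R) | refl , w , refl =
    ⊑-subAt w (trans (sym (subAt-++ t q w tq)) tr)
      (node (imgBelow⇒⊑ img-L (subAt-++ s p [ L ] sp) (subAt-++ t (q ++ w) [ L ] tr))
            (imgBelow⇒⊑ img-R (subAt-++ s p [ R ] sp) (subAt-++ t (q ++ w) [ R ] tr)))
  ... | _ , _ | _ , _ , tr | inj₂ (img-L , img-R) | refl , w , refl =
    ⊑-subAt w (trans (sym (subAt-++ t q w tq)) tr)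
      (swap (imgBelow⇒⊑ img-L (subAt-++ s p [ L ] sp) (subAt-++ t (q ++ w) [ R ] tr))
            (imgBelow⇒⊑ img-R (subAt-++ s p [ R ] sp) (subAt-++ t (q ++ w) [ L ] tr)))

-- A lone leaf has no inner vertex, so the morphism says nothing about it: hence the hypothesis on leaves.
≤F⇒⊑ : (s ∷ map leaf xs) ≤F (t ∷ []) → leaves s ⊆ leaves t → s ⊑ t
≤F⇒⊑ {s = leaf i} {t = t} _ s⊆t =
  let p , tp = ∈-leaves⇒subAt t (s⊆t (here refl)) in ⊑-subAt p tp (leaf i)
≤F⇒⊑ {s = node a b} {xs = xs} E _ =
  imgBelow⇒⊑ E {p = []} {q = []} (inj₁ (root , Inner-singleton⇒zero (inner _ root) , _ , refl)) refl refl
  where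
    open _≤F_ E
    root : Inner (node a b ∷ map leaf xs) (zero , [])
    root = a , b , refl

nodeᴹ : Maybe (BTree n) → Maybe (BTree n) → Maybe (BTree n)
nodeᴹ (just l) (just r) = just (node l r)
nodeᴹ (just l) nothing  = just l
nodeᴹ nothing  r        = r

leavesᴹ : Maybe (BTree n) → List (Fin n)
leavesᴹ (just t) = leaves t
leavesᴹ nothing  = []

leavesᴹ-nodeᴹ : ∀ (l r : Maybe (BTree n)) → leavesᴹ (nodeᴹ l r) ≡ leavesᴹ l ++ leavesᴹ r
leavesᴹ-nodeᴹ (just l) (just r) = refl
leavesᴹ-nodeᴹ (just l) nothing  = sym (++-identityʳ (leaves l))
leavesᴹ-nodeᴹ nothing  r        = refl

module _ {P : Pred (Fin n) ℓ} (P? : Decidable P) where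

  restrict : BTree n → Maybe (BTree n)
  restrict (leaf i) with P? i
  ... | yes _ = just (leaf i)
  ... | no  _ = nothing
  restrict (node l r) = nodeᴹ (restrict l) (restrict r)

  leaves-restrict : ∀ t → leavesᴹ (restrict t) ≡ filter P? (leaves t)
  leaves-restrict (leaf i) with P? i
  ... | yes _ = refl
  ... | no  _ = refl
  leaves-restrict (node l r) = begin
    leavesᴹ (nodeᴹ (restrict l) (restrict r))     ≡⟨ leavesᴹ-nodeᴹ (restrict l) (restrict r) ⟩
    leavesᴹ (restrict l) ++ leavesᴹ (restrict r)  ≡⟨ cong₂ _++_ (leaves-restrict l) (leaves-restrict r) ⟩
    filter P? (leaves l) ++ filter P? (leaves r)  ≡⟨ filter-++ P? (leaves l) (leaves r) ⟨
    filter P? (leaves l ++ leaves r)              ∎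
    where open ≡-Reasoning

  restrict-just : ∀ t → i ∈ leaves t → P i → ∃ λ r → restrict t ≡ just r
  restrict-just t i∈t Pi with restrict t in eq
  ... | just r  = r , refl
  ... | nothing = contradiction i∈[] λ ()
    where
      i∈[] : _ ∈ []
      i∈[] = subst (_ ∈_) (trans (sym (leaves-restrict t)) (cong leavesᴹ eq)) (∈-filter⁺ P? i∈t Pi)

  restrict-leaf : P i → restrict (leaf i) ≡ just (leaf i)
  restrict-leaf {i = i} Pi with P? i
  ... | yes _  = refl
  ... | no ¬Pi = contradiction Pi ¬Pi

  restrict-nothing : (∀ {i} → i ∈ leaves t → ¬ P i) → restrict t ≡ nothing
  restrict-nothing {t = leaf i} ¬P with P? i
  ... | yes Pi = contradiction Pi (¬P (here refl))
  ... | no  _  = refl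
  restrict-nothing {t = node l r} ¬P =
    cong₂ nodeᴹ (restrict-nothing {t = l} (¬P ∘ ∈-++⁺ˡ)) (restrict-nothing {t = r} (¬P ∘ ∈-++⁺ʳ (leaves l)))

  restrict⇒⊑ : restrict t ≡ just s → s ⊑ t
  restrict⇒⊑ {t = leaf i} eq with P? i | eq
  ... | yes _ | refl = leaf i
  restrict⇒⊑ {t = node l r} eq with restrict l in eqˡ | restrict r in eqʳ | eq
  ... | just _  | just _  | refl = node (restrict⇒⊑ eqˡ) (restrict⇒⊑ eqʳ)
  ... | just _  | nothing | refl = left (restrict⇒⊑ eqˡ)
  ... | nothing | just _  | refl = right (restrict⇒⊑ eqʳ)

  Selects : List (Fin n) → List (Fin n) → Set ℓ
  Selects xs ys = ∀ {i} → i ∈ ys → (i ∈ xs ⇔ P i)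

  Selects-⊆ : zs ⊆ ys → Selects xs ys → Selects xs zs
  Selects-⊆ zs⊆ys sel = sel ∘ zs⊆ys

  Selects-++⁻ˡ : Selects (xs ++ ys) zs → Disjoint zs ys → Selects xs zs
  Selects-++⁻ˡ {xs = xs} sel zs#ys i∈zs = mk⇔
    (Equivalence.to (sel i∈zs) ∘ ∈-++⁺ˡ)
    (λ Pi → Sum.[ id , (λ i∈ys → contradiction (i∈zs , i∈ys) zs#ys) ]
              (∈-++⁻ xs (Equivalence.from (sel i∈zs) Pi)))

  Selects-++⁻ʳ : Selects (xs ++ ys) zs → Disjoint zs xs → Selects ys zs
  Selects-++⁻ʳ {xs = xs} sel zs#xs i∈zs = mk⇔
    (Equivalence.to (sel i∈zs) ∘ ∈-++⁺ʳ xs)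
    (λ Pi → Sum.[ (λ i∈xs → contradiction (i∈zs , i∈xs) zs#xs) , id ]
              (∈-++⁻ xs (Equivalence.from (sel i∈zs) Pi)))

  ⊑-restrict : s ⊑ t → Unique (leaves t) → Selects (leaves s) (leaves t) →
               ∃ λ s′ → restrict t ≡ just s′ × s ≅ s′
  ⊑-restrict (leaf i) _ sel = leaf i , restrict-leaf (Equivalence.to (sel (here refl)) (here refl)) , leaf i
  ⊑-restrict (node {u = u} a⊑u b⊑v) uv! sel =
    let u! , v! , u#v  = Unique-++⁻ (leaves u) uv!
        a′ , ra , a≅a′ = ⊑-restrict a⊑u u! (Selects-++⁻ˡ (Selects-⊆ ∈-++⁺ˡ sel)
                           λ (i∈u , i∈b) → u#v (i∈u , ⊑⇒leaves⊆ b⊑v i∈b))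
        b′ , rb , b≅b′ = ⊑-restrict b⊑v v! (Selects-++⁻ʳ (Selects-⊆ (∈-++⁺ʳ (leaves u)) sel)
                           λ (i∈v , i∈a) → u#v (⊑⇒leaves⊆ a⊑u i∈a , i∈v))
    in node a′ b′ , cong₂ nodeᴹ ra rb , node a≅a′ b≅b′
  ⊑-restrict (swap {u = u} a⊑v b⊑u) uv! sel =
    let u! , v! , u#v  = Unique-++⁻ (leaves u) uv!
        b′ , rb , b≅b′ = ⊑-restrict b⊑u u! (Selects-++⁻ʳ (Selects-⊆ ∈-++⁺ˡ sel)
                           λ (i∈u , i∈a) → u#v (i∈u , ⊑⇒leaves⊆ a⊑v i∈a))
        a′ , ra , a≅a′ = ⊑-restrict a⊑v v! (Selects-++⁻ˡ (Selects-⊆ (∈-++⁺ʳ (leaves u)) sel)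
                           λ (i∈v , i∈b) → u#v (⊑⇒leaves⊆ b⊑u i∈b , i∈v))
    in node b′ a′ , cong₂ nodeᴹ rb ra , swap a≅a′ b≅b′
  ⊑-restrict (left {u = u} {v = v} s⊑u) uv! sel with Unique-++⁻ (leaves u) uv!
  ... | u! , _ , u#v =
    let s′ , rs , s≅s′ = ⊑-restrict s⊑u u! (Selects-⊆ ∈-++⁺ˡ sel)
    in s′ , cong₂ nodeᴹ rs (restrict-nothing {t = v} v-unselected) , s≅s′
    where
      v-unselected : ∀ {i} → i ∈ leaves v → ¬ P i
      v-unselected i∈v Pi = u#v (⊑⇒leaves⊆ s⊑u (Equivalence.from (sel (∈-++⁺ʳ (leaves u) i∈v)) Pi) , i∈v)
  ⊑-restrict (right {u = u} s⊑v) uv! sel with Unique-++⁻ (leaves u) uv!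
  ... | _ , v! , u#v =
    let s′ , rs , s≅s′ = ⊑-restrict s⊑v v! (Selects-⊆ (∈-++⁺ʳ (leaves u)) sel)
    in s′ , cong₂ nodeᴹ (restrict-nothing {t = u} u-unselected) rs , s≅s′
    where
      u-unselected : ∀ {i} → i ∈ leaves u → ¬ P i
      u-unselected i∈u Pi = u#v (i∈u , ⊑⇒leaves⊆ s⊑v (Equivalence.from (sel (∈-++⁺ˡ i∈u)) Pi))

restrict-isTreeOn : ∀ {K J : Subset n} {r} → IsTreeOn K t → restrict (_∈? J) t ≡ just r → IsTreeOn (K ∩ J) r
restrict-isTreeOn {t = t} {K} {J} {r} (t! , t-on-K) eq =
  subst Unique (sym r≡filter) (Unique.filter⁺ (_∈? J) t!) , λ i → mk⇔ (to i) (from i)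
  where
    r≡filter : leaves r ≡ filter (_∈? J) (leaves t)
    r≡filter = trans (cong leavesᴹ (sym eq)) (leaves-restrict (_∈? J) t)

    to : ∀ i → i ∈ leaves r → i ∈ₛ K ∩ J
    to i i∈r = let i∈t , i∈J = ∈-filter⁻ (_∈? J) (subst (i ∈_) r≡filter i∈r)
               in x∈p∩q⁺ (Equivalence.to (t-on-K i) i∈t , i∈J)

    from : ∀ i → i ∈ₛ K ∩ J → i ∈ leaves r
    from i i∈K∩J = let i∈K , i∈J = x∈p∩q⁻ K J i∈K∩J
                   in subst (i ∈_) (sym r≡filter) (∈-filter⁺ (_∈? J) (Equivalence.from (t-on-K i) i∈K) i∈J)

mainTheorem1 : ∀ {n} (T : BTree n) → IsTreeOn ⊤ T →
    (J : Subset n) → Nonempty J →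
    ∃ λ TJ → IsTreeOn J TJ × ((TJ ∷ bars (∁ J)) ≤F (T ∷ []))
      × (∀ T′ → IsTreeOn J T′ → (T′ ∷ bars (∁ J)) ≤F (T ∷ []) → T′ ≅ TJ)
mainTheorem1 T T-on-⊤@(T! , _) J (j , j∈J) =
  let TJ , T↾J = restrict-just (_∈? J) T leaf-of-T j∈J in
    TJ
  , subst (λ K → IsTreeOn K TJ) (∩-identityˡ J) (restrict-isTreeOn {t = T} T-on-⊤ T↾J)
  , ⊑⇒≤F (restrict⇒⊑ (_∈? J) T↾J)
  , λ T′ (_ , T′-on-J) T′≤T →
      let T′⊑T             = ≤F⇒⊑ T′≤T (λ _ → leaf-of-T)
          T″ , T↾J′ , T′≅T″ = ⊑-restrict (_∈? J) T′⊑T T! (λ {i} _ → T′-on-J i)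
      in subst (T′ ≅_) (just-injective (trans (sym T↾J′) T↾J)) T′≅T″
  where
    leaf-of-T : ∀ {i} → i ∈ leaves T
    leaf-of-T {i} = Equivalence.from (proj₂ T-on-⊤ i) ∈⊤
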